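{- Let $s$ and $t$ be two distinct elements of $\mathbb{Z}\setminus\{0,1\}$ such that $s$ divides $t$. Then $\Gamma(\mathbb{Z},\{s,t\})$ has an efficient dominating set if and only if $t/s\equiv 2\pmod 3$.
   Context: The digraph $\Gamma(\mathbb{Z},\{s,t\})$ has vertex set $\mathbb{Z}$ and directed edges $(g,g+s)$ and $(g,g+t)$ for all $g\in\mathbb{Z}$. A vertex $u$ dominates $v$ if $u=v$ or $(u,v)$ is an edge. An efficient dominating set is a set $D\subseteq\mathbb{Z}$ such that every integer is dominated by exactly one element of $D$. -}

module Defs where

open import Data.Integer using (ℤ; _+_)
open import Data.Product using (∃!; _×_)
open import Data.Sum using (_⊎_)
open import Relation.Binary.PropositionalEquality using (_≡_)

-- In the digraph Γ(ℤ,{s,t}) (edges (g,g+s), (g,g+t)), u dominates v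
-- iff u = v or (u,v) is an edge.
Dominates : ℤ → ℤ → ℤ → ℤ → Set
Dominates s t u v = (u ≡ v) ⊎ ((v ≡ u + s) ⊎ (v ≡ u + t))

IsEfficientDominatingSet : ℤ → ℤ → (ℤ → Set) → Set
IsEfficientDominatingSet s t D =
  ∀ (v : ℤ) → ∃! _≡_ (λ u → D u × Dominates s t u v)

HasEfficientDominatingSet : ℤ → ℤ → Set₁
HasEfficientDominatingSet s t = ∃ (IsEfficientDominatingSet s t)
  where open import Data.Product using (∃)

-- Necessity: in an efficient dominating set D no two elements differ by s, t or 2s, so the
-- dominator of a + 2s (a ∈ D) must be a + 2s − t, and then the dominator of a + 3s can only be
-- a + 3s itself; hence D is closed under translation by 3s. Writing t = (r + 3j) s, some e and
-- e + 3js lie in D: for r = 0 that puts e + t in D, and for r = 1 both e and e + t − s dominate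
-- e + t. So r = 2.
-- Sufficiency: for q = t/s ≡ 2 (mod 3) take D = {x | ⌊x/s⌋ ≡ 0 (mod 3)}. The only possible
-- dominators v, v − s, v − t of v have quotients m, m − 1, m − q ≡ m + 1 (mod 3), exactly one of
-- which is divisible by 3.

module Submission where

open import Defs
open import Data.Integer using (ℤ; +_)
open import Data.Integer.DivMod using (_%ℕ_)
open import Data.Integer.Divisibility.Signed using (_∣_; quotient)
open import Relation.Binary.PropositionalEquality using (_≡_)
open import Relation.Nullary using (¬_)
open import Function.Bundles using (_⇔_)

open import Data.Integer
  using (-[1+_]; 0ℤ; 1ℤ; _+_; _*_; _-_; -_; ∣_∣; _⊖_; _/ℕ_; _/_; _%_; NonZero; ≢-nonZero)
open import Data.Integer.Properties
  using (+-0-abelianGroup; +-commutativeSemigroup; +-identityʳ; *-identityˡ; +-injective;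
         ∣i∣≡0⇒i≡0; ∣i*j∣≡∣i∣*∣j∣; ∣m⊝n∣≤m⊔n; m-n≡m⊖n; i-j≡0⇒i≡j)
open import Data.Integer.DivMod using (a≡a%ℕn+[a/ℕn]*n; a≡a%n+[a/n]*n; n%ℕd<d; n%d<d)
open import Data.Integer.Divisibility.Signed using (divides)
open import Data.Integer.Tactic.RingSolver using (solve-∀)
open import Algebra.Properties.AbelianGroup +-0-abelianGroup
  using (∙-cancelˡ; ∙-cancelʳ; identityʳ-unique; //-rightDividesˡ; //-rightDividesʳ)
open import Algebra.Properties.CommutativeSemigroup +-commutativeSemigroup using (xy∙z≈xz∙y)
import Data.Nat as ℕ
open import Data.Nat using (ℕ; zero; suc; s<s)
import Data.Nat.Properties as ℕ
open import Data.Empty using (⊥-elim)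
open import Data.Product using (∃; ∃!; _×_; _,_)
open import Data.Sum using (_⊎_; inj₁; inj₂)
open import Relation.Binary.PropositionalEquality using (_≢_; refl; sym; trans; cong; subst; module ≡-Reasoning)
open import Relation.Nullary using (contradiction)
open import Function.Base using (_∘_)
open import Function.Bundles using (mk⇔)

m*n<n⇒m≡0 : ∀ m n → m ℕ.* n ℕ.< n → m ≡ 0
m*n<n⇒m≡0 zero    n _  = refl
m*n<n⇒m≡0 (suc m) n lt = contradiction lt (ℕ.m+n≮m n (m ℕ.* n))

quotient-unique : ∀ d {r r′ a b} → r ℕ.< ∣ d ∣ → r′ ℕ.< ∣ d ∣ →
                  + r + a * d ≡ + r′ + b * d → a ≡ b
quotient-unique d {r} {r′} {a} {b} r<d r′<d eq =
  i-j≡0⇒i≡j a b (∣i∣≡0⇒i≡0 (m*n<n⇒m≡0 ∣ a - b ∣ ∣ d ∣ ∣a-b∣*∣d∣<∣d∣))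
  where
  expand : ∀ x y z w → (x - y) * w ≡ (z + x * w) - (z + y * w)
  expand = solve-∀
  collapse : ∀ x y z → (x + y) - (z + y) ≡ x - z
  collapse = solve-∀
  [a-b]*d≡r′⊖r : (a - b) * d ≡ r′ ⊖ r
  [a-b]*d≡r′⊖r = begin
    (a - b) * d                     ≡⟨ expand a b (+ r) d ⟩
    (+ r + a * d) - (+ r + b * d)   ≡⟨ cong (_- (+ r + b * d)) eq ⟩
    (+ r′ + b * d) - (+ r + b * d)  ≡⟨ collapse (+ r′) (b * d) (+ r) ⟩
    + r′ - + r                      ≡⟨ m-n≡m⊖n r′ r ⟩
    r′ ⊖ r                          ∎
    where open ≡-Reasoning
  ∣a-b∣*∣d∣<∣d∣ : ∣ a - b ∣ ℕ.* ∣ d ∣ ℕ.< ∣ d ∣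
  ∣a-b∣*∣d∣<∣d∣ = begin-strict
    ∣ a - b ∣ ℕ.* ∣ d ∣   ≡⟨ ∣i*j∣≡∣i∣*∣j∣ (a - b) d ⟨
    ∣ (a - b) * d ∣       ≡⟨ cong ∣_∣ [a-b]*d≡r′⊖r ⟩
    ∣ r′ ⊖ r ∣            ≤⟨ ∣m⊝n∣≤m⊔n r′ r ⟩
    r′ ℕ.⊔ r              <⟨ ℕ.⊔-lub r′<d r<d ⟩
    ∣ d ∣                 ∎
    where open ℕ.≤-Reasoning

/-unique : ∀ {x} d .{{_ : NonZero d}} {r j} → x ≡ + r + j * d → r ℕ.< ∣ d ∣ → x / d ≡ j
/-unique {x} d x≡r+jd r<d =
  quotient-unique d (n%d<d x d) r<d (trans (sym (a≡a%n+[a/n]*n x d)) x≡r+jd)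

%ℕ-unique : ∀ {x} d .{{_ : ℕ.NonZero d}} {r j} → x ≡ + r + j * + d → r ℕ.< d → x %ℕ d ≡ r
%ℕ-unique {x} d {r} {j} x≡r+jd r<d = +-injective (∙-cancelʳ (j * + d) _ _ (begin
  + (x %ℕ d) + j * + d         ≡⟨ cong (λ k → + (x %ℕ d) + k * + d) j≡x/d ⟩
  + (x %ℕ d) + (x /ℕ d) * + d  ≡⟨ a≡a%ℕn+[a/ℕn]*n x d ⟨
  x                            ≡⟨ x≡r+jd ⟩
  + r + j * + d                ∎))
  where
  open ≡-Reasoning
  j≡x/d : j ≡ x /ℕ d
  j≡x/d = quotient-unique (+ d) r<d (n%ℕd<d x d) (trans (sym x≡r+jd) (a≡a%ℕn+[a/ℕn]*n x d))

[x-kd]/d≡x/d-k : ∀ x k d .{{_ : NonZero d}} → (x - k * d) / d ≡ x / d - k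
[x-kd]/d≡x/d-k x k d = /-unique d {j = x / d - k} (begin
  x - k * d                              ≡⟨ cong (_- k * d) (a≡a%n+[a/n]*n x d) ⟩
  + (x % d) + (x / d) * d - k * d        ≡⟨ regroup (+ (x % d)) (x / d) k d ⟩
  + (x % d) + (x / d - k) * d            ∎) (n%d<d x d)
  where
  open ≡-Reasoning
  regroup : ∀ r a k d → r + a * d - k * d ≡ r + (a - k) * d
  regroup = solve-∀

[x+kd]%ℕd≡x%ℕd : ∀ x k d .{{_ : ℕ.NonZero d}} → (x + k * + d) %ℕ d ≡ x %ℕ d
[x+kd]%ℕd≡x%ℕd x k d = %ℕ-unique d {j = x /ℕ d + k} (begin
  x + k * + d                                  ≡⟨ cong (_+ k * + d) (a≡a%ℕn+[a/ℕn]*n x d) ⟩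
  + (x %ℕ d) + (x /ℕ d) * + d + k * + d        ≡⟨ regroup (+ (x %ℕ d)) (x /ℕ d) k (+ d) ⟩
  + (x %ℕ d) + (x /ℕ d + k) * + d              ∎) (n%ℕd<d x d)
  where
  open ≡-Reasoning
  regroup : ∀ r a k d → r + a * d + k * d ≡ r + (a + k) * d
  regroup = solve-∀

[x+c]%ℕd≡[x%ℕd+c]%ℕd : ∀ x c d .{{_ : ℕ.NonZero d}} → (x + c) %ℕ d ≡ (+ (x %ℕ d) + c) %ℕ d
[x+c]%ℕd≡[x%ℕd+c]%ℕd x c d = begin
  (x + c) %ℕ d                                 ≡⟨ cong (λ y → (y + c) %ℕ d) (a≡a%ℕn+[a/ℕn]*n x d) ⟩
  (+ (x %ℕ d) + (x /ℕ d) * + d + c) %ℕ d       ≡⟨ cong (_%ℕ d) (xy∙z≈xz∙y (+ (x %ℕ d)) _ c) ⟩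
  (+ (x %ℕ d) + c + (x /ℕ d) * + d) %ℕ d       ≡⟨ [x+kd]%ℕd≡x%ℕd (+ (x %ℕ d) + c) (x /ℕ d) d ⟩
  (+ (x %ℕ d) + c) %ℕ d                        ∎
  where open ≡-Reasoning

module _ {P : ℤ → Set} (c : ℤ) (closed : ∀ {a} → P a → P (a + c)) where

  closed-+n*c : ∀ {a} n → P a → P (a + + n * c)
  closed-+n*c {a} zero    Pa = subst P (sym (+-identityʳ a)) Pa
  closed-+n*c {a} (suc n) Pa = subst P (step a (+ n) c) (closed (closed-+n*c n Pa))
    where
    step : ∀ a m c → a + m * c + c ≡ a + (1ℤ + m) * c
    step = solve-∀

  pair-at-multiple : ∀ {a} → P a → ∀ k → ∃ λ e → P e × P (e + k * c)
  pair-at-multiple Pa (+ n)        = _ , Pa , closed-+n*c n Pa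
  pair-at-multiple {a} Pa -[1+ n ] = _ , closed-+n*c (suc n) Pa , subst P (sym (back a (+ suc n) c)) Pa
    where
    back : ∀ a m c → a + m * c + (- m) * c ≡ a
    back = solve-∀

dominator-candidates : ∀ {s t u v} → Dominates s t u v → u ≡ v ⊎ u ≡ v - s ⊎ u ≡ v - t
dominator-candidates         (inj₁ u≡v)          = inj₁ u≡v
dominator-candidates {s} {u = u} (inj₂ (inj₁ v≡u+s)) =
  inj₂ (inj₁ (sym (trans (cong (_- s) v≡u+s) (//-rightDividesʳ s u))))
dominator-candidates {t = t} {u} (inj₂ (inj₂ v≡u+t)) =
  inj₂ (inj₂ (sym (trans (cong (_- t) v≡u+t) (//-rightDividesʳ t u))))

unique-dominator : ∀ {s t v} {D : ℤ → Set} w → D w → Dominates s t w v →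
                   (D v → w ≡ v) → (D (v - s) → w ≡ v - s) → (D (v - t) → w ≡ v - t) →
                   ∃! _≡_ (λ u → D u × Dominates s t u v)
unique-dominator {s} {t} {v} {D} w Dw w→v at-v at-v-s at-v-t = w , (Dw , w→v) , λ (Du , u→v) →
  w≡candidate Du (dominator-candidates u→v)
  where
  w≡candidate : ∀ {u} → D u → u ≡ v ⊎ u ≡ v - s ⊎ u ≡ v - t → w ≡ u
  w≡candidate Du (inj₁ refl)        = at-v Du
  w≡candidate Du (inj₂ (inj₁ refl)) = at-v-s Du
  w≡candidate Du (inj₂ (inj₂ refl)) = at-v-t Du

module Necessity {s t : ℤ} (s≢0 : s ≢ 0ℤ) (t≢0 : t ≢ 0ℤ) (s≢t : s ≢ t)
                 {D : ℤ → Set} (efficient : IsEfficientDominatingSet s t D) where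

  dominated-once : ∀ {a b v} → D a → D b → Dominates s t a v → Dominates s t b v → a ≡ b
  dominated-once {v = v} Da Db a→v b→v with efficient v
  ... | _ , _ , unique = trans (sym (unique (Da , a→v))) (unique (Db , b→v))

  apart : ∀ {a x} → x ≢ 0ℤ → Dominates s t a (a + x) → D a → ¬ D (a + x)
  apart {a} {x} x≢0 a→a+x Da Da+x =
    x≢0 (identityʳ-unique a x (sym (dominated-once Da Da+x a→a+x (inj₁ refl))))

  apart-s : ∀ {a} → D a → ¬ D (a + s)
  apart-s = apart s≢0 (inj₂ (inj₁ refl))

  apart-t : ∀ {a} → D a → ¬ D (a + t)
  apart-t = apart t≢0 (inj₂ (inj₂ refl))

  apart-2s : ∀ {a} → D a → ¬ D (a + s + s)
  apart-2s {a} Da Da+2s with efficient (a + s + t)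
  ... | u , (Du , inj₁ refl) , _ = s≢t (sym (∙-cancelˡ (a + s) t s
          (dominated-once Du Da+2s (inj₂ (inj₁ refl)) (inj₂ (inj₂ (xy∙z≈xz∙y (a + s) t s))))))
  ... | u , (Du , inj₂ (inj₁ e)) , _ =
    apart-t Da (subst D (∙-cancelʳ s u (a + t) (trans (sym e) (xy∙z≈xz∙y a s t))) Du)
  ... | u , (Du , inj₂ (inj₂ e)) , _ = apart-s Da (subst D (∙-cancelʳ t u (a + s) (sym e)) Du)

  dominated-via-t : ∀ {a u} → D a → D u → Dominates s t u (a + s + s) → a + s + s ≡ u + t
  dominated-via-t Da Du (inj₁ refl)             = ⊥-elim (apart-2s Da Du)
  dominated-via-t {a} {u} Da Du (inj₂ (inj₁ e)) =
    ⊥-elim (apart-s Da (subst D (sym (∙-cancelʳ s (a + s) u e)) Du))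
  dominated-via-t Da Du (inj₂ (inj₂ e))         = e

  closed-+s+s+s : ∀ {a} → D a → D (a + s + s + s)
  closed-+s+s+s {a} Da with efficient (a + s + s) | efficient (a + s + s + s)
  ... | u , (Du , u→) , _ | w , (Dw , w→) , _ = from-dominator w→ Dw
    where
    a+2s≡u+t : a + s + s ≡ u + t
    a+2s≡u+t = dominated-via-t Da Du u→
    from-dominator : ∀ {w} → Dominates s t w (a + s + s + s) → D w → D (a + s + s + s)
    from-dominator (inj₁ refl)     Dw = Dw
    from-dominator {w} (inj₂ (inj₁ e)) Dw =
      ⊥-elim (apart-t Du (subst D (trans (sym (∙-cancelʳ s (a + s + s) w e)) a+2s≡u+t) Dw))
    from-dominator {w} (inj₂ (inj₂ e)) Dw =
      ⊥-elim (apart-s Du (subst D (∙-cancelʳ t w (u + s)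
        (trans (sym e) (trans (cong (_+ s) a+2s≡u+t) (xy∙z≈xz∙y u t s)))) Dw))

  closed-+3s : ∀ {a} → D a → D (a + + 3 * s)
  closed-+3s {a} Da = subst D (triple a s) (closed-+s+s+s Da)
    where
    triple : ∀ a s → a + s + s + s ≡ a + + 3 * s
    triple = solve-∀

  quotient%3≡2 : ∀ {q} → t ≡ q * s → q %ℕ 3 ≡ 2
  quotient%3≡2 {q} t≡qs with efficient 0ℤ
  ... | d , (Dd , _) , _ with pair-at-multiple (+ 3 * s) closed-+3s Dd (q /ℕ 3)
  ...   | e , De , De′ = remainder≡2 (q %ℕ 3) (n%ℕd<d q 3) (a≡a%ℕn+[a/ℕn]*n q 3)
    where
    remainder≡2 : ∀ r → r ℕ.< 3 → q ≡ + r + (q /ℕ 3) * + 3 → r ≡ 2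
    remainder≡2 0 _ q≡3j = ⊥-elim (apart-t De (subst D (cong (_+_ e) (sym t≡3js)) De′))
      where
      expand : ∀ j s → (+ 0 + j * + 3) * s ≡ j * (+ 3 * s)
      expand = solve-∀
      t≡3js : t ≡ (q /ℕ 3) * (+ 3 * s)
      t≡3js = trans t≡qs (trans (cong (_* s) q≡3j) (expand (q /ℕ 3) s))
    remainder≡2 1 _ q≡1+3j = ⊥-elim (s≢t (sym (∙-cancelˡ e t s (begin
      e + t                            ≡⟨ e+t≡e′+s ⟩
      e + (q /ℕ 3) * (+ 3 * s) + s     ≡⟨ cong (_+ s) e≡e′ ⟨
      e + s                            ∎))))
      where
      open ≡-Reasoning
      expand : ∀ e j s → e + (+ 1 + j * + 3) * s ≡ e + j * (+ 3 * s) + s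
      expand = solve-∀
      e+t≡e′+s : e + t ≡ e + (q /ℕ 3) * (+ 3 * s) + s
      e+t≡e′+s = trans (cong (_+_ e) (trans t≡qs (cong (_* s) q≡1+3j))) (expand e (q /ℕ 3) s)
      e≡e′ : e ≡ e + (q /ℕ 3) * (+ 3 * s)
      e≡e′ = dominated-once De De′ (inj₂ (inj₂ refl)) (inj₂ (inj₁ e+t≡e′+s))
    remainder≡2 2 _ _ = refl
    remainder≡2 (suc (suc (suc _))) (s<s (s<s (s<s ()))) _

module Sufficiency {s t q : ℤ} .{{_ : NonZero s}} (t≡qs : t ≡ q * s) (q%3≡2 : q %ℕ 3 ≡ 2) where

  residue : ℤ → ℕ
  residue x = (x / s) %ℕ 3

  D : ℤ → Set
  D x = residue x ≡ 0

  ¬D : ∀ x {n} → residue x ≡ suc n → ¬ D x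
  ¬D _ r Dx = ℕ.1+n≢0 (trans (sym r) Dx)

  residue-s : ∀ v {ρ} → residue v ≡ ρ → residue (v - s) ≡ (+ ρ - 1ℤ) %ℕ 3
  residue-s v refl = begin
    ((v - s) / s) %ℕ 3        ≡⟨ cong (λ x → ((v - x) / s) %ℕ 3) (*-identityˡ s) ⟨
    ((v - 1ℤ * s) / s) %ℕ 3   ≡⟨ cong (_%ℕ 3) ([x-kd]/d≡x/d-k v 1ℤ s) ⟩
    (v / s - 1ℤ) %ℕ 3         ≡⟨ [x+c]%ℕd≡[x%ℕd+c]%ℕd (v / s) (- 1ℤ) 3 ⟩
    (+ residue v - 1ℤ) %ℕ 3   ∎
    where open ≡-Reasoning

  residue-t : ∀ v {ρ} → residue v ≡ ρ → residue (v - t) ≡ (+ ρ + 1ℤ) %ℕ 3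
  residue-t v refl = begin
    ((v - t) / s) %ℕ 3                            ≡⟨ cong (λ x → ((v - x) / s) %ℕ 3) t≡qs ⟩
    ((v - q * s) / s) %ℕ 3                        ≡⟨ cong (_%ℕ 3) ([x-kd]/d≡x/d-k v q s) ⟩
    (v / s - q) %ℕ 3                              ≡⟨ cong (λ x → (v / s - x) %ℕ 3) q≡2+3k ⟩
    (v / s - (+ 2 + k * + 3)) %ℕ 3                ≡⟨ cong (_%ℕ 3) (regroup (v / s) k) ⟩
    (v / s + 1ℤ + (- (k + 1ℤ)) * + 3) %ℕ 3        ≡⟨ [x+kd]%ℕd≡x%ℕd (v / s + 1ℤ) (- (k + 1ℤ)) 3 ⟩
    (v / s + 1ℤ) %ℕ 3                             ≡⟨ [x+c]%ℕd≡[x%ℕd+c]%ℕd (v / s) 1ℤ 3 ⟩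
    (+ residue v + 1ℤ) %ℕ 3                       ∎
    where
    open ≡-Reasoning
    k : ℤ
    k = q /ℕ 3
    q≡2+3k : q ≡ + 2 + k * + 3
    q≡2+3k = subst (λ r → q ≡ + r + k * + 3) q%3≡2 (a≡a%ℕn+[a/ℕn]*n q 3)
    regroup : ∀ m k → m - (+ 2 + k * + 3) ≡ m + 1ℤ + (- (k + 1ℤ)) * + 3
    regroup = solve-∀

  efficient : IsEfficientDominatingSet s t D
  efficient v = by-residue (residue v) refl (n%ℕd<d (v / s) 3)
    where
    v-s→v : Dominates s t (v - s) v
    v-s→v = inj₂ (inj₁ (sym (//-rightDividesˡ s v)))
    v-t→v : Dominates s t (v - t) v
    v-t→v = inj₂ (inj₂ (sym (//-rightDividesˡ t v)))
    by-residue : ∀ ρ → residue v ≡ ρ → ρ ℕ.< 3 → ∃! _≡_ (λ u → D u × Dominates s t u v)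
    by-residue 0 r _ = unique-dominator {D = D} v r (inj₁ refl)
      (λ _ → refl)
      (⊥-elim ∘ ¬D (v - s) (residue-s v r))
      (⊥-elim ∘ ¬D (v - t) (residue-t v r))
    by-residue 1 r _ = unique-dominator {D = D} (v - s) (residue-s v r) v-s→v
      (⊥-elim ∘ ¬D v r)
      (λ _ → refl)
      (⊥-elim ∘ ¬D (v - t) (residue-t v r))
    by-residue 2 r _ = unique-dominator {D = D} (v - t) (residue-t v r) v-t→v
      (⊥-elim ∘ ¬D v r)
      (⊥-elim ∘ ¬D (v - s) (residue-s v r))
      (λ _ → refl)
    by-residue (suc (suc (suc _))) _ (s<s (s<s (s<s ())))

corollary5p5 : (s t : ℤ) → ¬ (s ≡ + 0) → ¬ (s ≡ + 1) → ¬ (t ≡ + 0) → ¬ (t ≡ + 1)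
    → ¬ (s ≡ t) → (h : s ∣ t)
    → HasEfficientDominatingSet s t ⇔ (quotient h %ℕ 3 ≡ 2)
corollary5p5 s t s≢0 _ t≢0 _ s≢t (divides q t≡qs) = mk⇔ necessary sufficient
  where
  instance
    s-nonZero : NonZero s
    s-nonZero = ≢-nonZero s≢0
  necessary : HasEfficientDominatingSet s t → q %ℕ 3 ≡ 2
  necessary (_ , efficient) = Necessity.quotient%3≡2 s≢0 t≢0 s≢t efficient {q} t≡qs
  sufficient : q %ℕ 3 ≡ 2 → HasEfficientDominatingSet s t
  sufficient q%3≡2 = _ , Sufficiency.efficient {q = q} t≡qs q%3≡2
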